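{- Let $d$ be a positive integer. $H_d$ is uncollapsed if and only if $H_{d/p} \neq H_d$ for all primes $p$ dividing $d$.
   Context: For a positive integer $m$, $H_m = \langle a,b,c \mid a^2,b^2,c^2,(ab)^3,(ac)^2,(bc)^m,(bac)^m\rangle$. We write $H_m = H_k$ if the two presentations define the same quotient of the free group on $a,b,c$ (the normal closures of the relator sets coincide). $H_m$ is uncollapsed if $H_m \neq H_k$ for all integers $1\le k<m$. -}

module Defs where

open import Data.Nat using (ℕ; zero; suc; _≤_; _<_)
open import Data.Nat.Divisibility using (_∣_; quotient)
open import Data.Nat.Primality using (Prime)
open import Data.Fin using (Fin; zero; suc)
open import Data.Bool using (Bool; true; false; not)
open import Data.Product using (_×_; _,_)
open import Data.List using (List; []; _∷_; _++_; reverse; map; concat; replicate)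
open import Data.List.Membership.Propositional using (_∈_)
open import Relation.Binary.Construct.Closure.Equivalence using (EqClosure)
open import Relation.Nullary using (¬_)
open import Function.Bundles using (_⇔_)

-- Letters of the free group on three generators a, b, c
-- (Fin 3: 0 = a, 1 = b, 2 = c); the Bool flag is true for an inverse letter.
Letter : Set
Letter = Fin 3 × Bool

Word : Set
Word = List Letter

invL : Letter → Letter
invL (x , e) = (x , not e)

inv : Word → Word
inv w = reverse (map invL w)

data FreeStep : Word → Word → Set where
  cancel : ∀ u x v → FreeStep (u ++ (x ∷ invL x ∷ v)) (u ++ v)

FreeEq : Word → Word → Set
FreeEq = EqClosure FreeStep

data NC (R : Word → Set) : Word → Set where
  nc-rel  : ∀ {r} → R r → NC R r
  nc-one  : NC R []
  nc-mul  : ∀ {u v} → NC R u → NC R v → NC R (u ++ v)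
  nc-inv  : ∀ {u} → NC R u → NC R (inv u)
  nc-conj : ∀ g {u} → NC R u → NC R (g ++ u ++ inv g)
  nc-free : ∀ {u v} → FreeEq u v → NC R u → NC R v

a b c : Word
a = (zero , false) ∷ []
b = (suc zero , false) ∷ []
c = (suc (suc zero) , false) ∷ []

pow : Word → ℕ → Word
pow w n = concat (replicate n w)

relators : ℕ → List Word
relators m =
  pow a 2 ∷ pow b 2 ∷ pow c 2 ∷ pow (a ++ b) 3 ∷ pow (a ++ c) 2
  ∷ pow (b ++ c) m ∷ pow (b ++ a ++ c) m ∷ []

Rel : ℕ → Word → Set
Rel m w = w ∈ relators m

SameH : ℕ → ℕ → Set
SameH m k = ∀ w → NC (Rel m) w ⇔ NC (Rel k) w

Uncollapsed : ℕ → Set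
Uncollapsed m = ∀ k → 1 ≤ k → k < m → ¬ SameH m k

module Submission where

-- For a word w and a normal closure N, the exponents n with
-- wⁿ ∈ N are closed under differences and multiples, hence (by Bézout) under
-- gcd.  The presentations H_m and H_n share all relators except (bc)^m,
-- (bac)^m, so the relators of H_m hold in H_n as soon as these two powers
-- lie in the normal closure of the relators of H_n; in particular
-- H_m = H_n whenever m ∣ n and the m-th powers hold in H_n.
--   (⇒) For a prime p ∣ d, the index d/p is positive and smaller than d,
--       so H_{d/p} = H_d would contradict uncollapsedness.
--   (⇐) If H_k = H_d with 1 ≤ k < d, then the k-th and the d-th powers
--       hold in H_d, hence so do the g-th powers for g = gcd d k, a proper
--       divisor of d.  For a prime p dividing d/g, the index d/p is a
--       multiple of g and a divisor of d, so H_{d/p} = H_d.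

open import Defs
open import Data.Nat using (ℕ; zero; suc; _+_; _*_; _≤_; _<_; s≤s; z≤n; NonZero; >-nonZero; >-nonZero⁻¹)
open import Data.Nat.Properties using (+-comm; *-comm; *-assoc; +-identityʳ; <-irrefl; ≤-<-trans)
open import Data.Nat.Divisibility
  using (_∣_; divides; quotient; ∣⇒≤; m∣m*n; quotient-∣; quotient-<; quotient≢0)
open import Data.Nat.GCD using (gcd; gcd-GCD; gcd[m,n]∣m; gcd[m,n]∣n; module Bézout)
open import Data.Nat.Primality using (Prime; prime⇒nonTrivial)
open import Data.Nat.Primality.Factorisation using (factorise)
open import Data.Bool.Properties using (not-involutive)
open import Data.List using ([]; _∷_; _++_; map)
open import Data.List.Properties using (++-assoc; unfold-reverse)
open import Data.List.Relation.Unary.All using (_∷_)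
open import Data.List.Relation.Unary.Any using (here; there)
open import Data.Product using (_×_; _,_; Σ-syntax)
open import Data.Empty using (⊥-elim)
open import Relation.Nullary using (¬_)
open import Function.Bundles using (_⇔_; mk⇔; Equivalence)
import Function.Properties.Equivalence as ⇔
open import Relation.Binary.PropositionalEquality
  using (_≡_; refl; sym; trans; cong; subst; module ≡-Reasoning)
open import Relation.Binary.Construct.Closure.ReflexiveTransitive using (ε; _◅_)
open import Relation.Binary.Construct.Closure.Symmetric using (fwd)

invL-involutive : ∀ x → invL (invL x) ≡ x
invL-involutive (i , e) = cong (i ,_) (not-involutive e)

inv-cancelˡ : ∀ u v → FreeEq (inv u ++ u ++ v) v
inv-cancelˡ [] v = ε
inv-cancelˡ (x ∷ u) v =
  subst (λ z → FreeEq z v) (sym regroup)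
    (fwd (cancel (inv u) (invL x) (u ++ v)) ◅ inv-cancelˡ u v)
  where
  open ≡-Reasoning
  regroup : inv (x ∷ u) ++ x ∷ u ++ v ≡ inv u ++ invL x ∷ invL (invL x) ∷ u ++ v
  regroup = begin
    inv (x ∷ u) ++ x ∷ u ++ v
      ≡⟨ cong (_++ x ∷ u ++ v) (unfold-reverse (invL x) (map invL u)) ⟩
    (inv u ++ invL x ∷ []) ++ x ∷ u ++ v
      ≡⟨ ++-assoc (inv u) (invL x ∷ []) (x ∷ u ++ v) ⟩
    inv u ++ invL x ∷ x ∷ u ++ v
      ≡⟨ cong (λ y → inv u ++ invL x ∷ y ∷ u ++ v) (sym (invL-involutive x)) ⟩
    inv u ++ invL x ∷ invL (invL x) ∷ u ++ v ∎

pow-+ : ∀ w m n → pow w (m + n) ≡ pow w m ++ pow w n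
pow-+ w zero    n = refl
pow-+ w (suc m) n = trans (cong (w ++_) (pow-+ w m n)) (sym (++-assoc w (pow w m) (pow w n)))

NC-⊆ : ∀ {R S : Word → Set} → (∀ r → R r → NC S r) → ∀ {u} → NC R u → NC S u
NC-⊆ R⊆S (nc-rel r)    = R⊆S _ r
NC-⊆ R⊆S nc-one        = nc-one
NC-⊆ R⊆S (nc-mul p q)  = nc-mul (NC-⊆ R⊆S p) (NC-⊆ R⊆S q)
NC-⊆ R⊆S (nc-inv p)    = nc-inv (NC-⊆ R⊆S p)
NC-⊆ R⊆S (nc-conj g p) = nc-conj g (NC-⊆ R⊆S p)
NC-⊆ R⊆S (nc-free e p) = nc-free e (NC-⊆ R⊆S p)

module Vanishing {R : Word → Set} (w : Word) where

  Vanishes : ℕ → Set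
  Vanishes n = NC R (pow w n)

  -- wⁿ and wⁿ⁺ʳ vanish, hence so does wʳ = w⁻ⁿ wⁿ⁺ʳ.
  vanishes-∸ : ∀ n r → Vanishes n → Vanishes (n + r) → Vanishes r
  vanishes-∸ n r wⁿ wⁿ⁺ʳ =
    nc-free (inv-cancelˡ (pow w n) (pow w r)) (nc-mul (nc-inv wⁿ) (subst (NC R) (pow-+ w n r) wⁿ⁺ʳ))

  vanishes-* : ∀ n → Vanishes n → ∀ r → Vanishes (r * n)
  vanishes-* n wⁿ zero    = nc-one
  vanishes-* n wⁿ (suc r) = subst (NC R) (sym (pow-+ w n (r * n))) (nc-mul wⁿ (vanishes-* n wⁿ r))

  vanishes-∣ : ∀ n m → Vanishes n → n ∣ m → Vanishes m
  vanishes-∣ n _ wⁿ (divides r refl) = vanishes-* n wⁿ r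

  -- Bézout: gcd m n + y n = x m (or symmetrically), so gcd m n is a difference of multiples.
  vanishes-gcd : ∀ m n → Vanishes m → Vanishes n → Vanishes (gcd m n)
  vanishes-gcd m n wᵐ wⁿ with Bézout.identity (gcd-GCD m n)
  ... | Bézout.+- x y eq = vanishes-∸ (y * n) (gcd m n) (vanishes-* n wⁿ y)
          (subst Vanishes (trans (sym eq) (+-comm (gcd m n) (y * n))) (vanishes-* m wᵐ x))
  ... | Bézout.-+ x y eq = vanishes-∸ (x * m) (gcd m n) (vanishes-* m wᵐ x)
          (subst Vanishes (trans (sym eq) (+-comm (gcd m n) (x * m))) (vanishes-* n wⁿ y))

open Vanishing using (vanishes-∣; vanishes-gcd)

-- The two relators of H_m whose exponent depends on m.
bc bac : Word
bc  = b ++ c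
bac = b ++ a ++ c

record Satisfies (n m : ℕ) : Set where
  constructor satisfies
  field
    bc-vanishes  : NC (Rel n) (pow bc m)
    bac-vanishes : NC (Rel n) (pow bac m)
open Satisfies

satisfies-own : ∀ n → Satisfies n n
satisfies-own n = satisfies (nc-rel (there (there (there (there (there (here refl)))))))
                            (nc-rel (there (there (there (there (there (there (here refl))))))))

satisfies-∣ : ∀ {n m k} → Satisfies n m → m ∣ k → Satisfies n k
satisfies-∣ {m = m} {k} (satisfies bcᵐ bacᵐ) m∣k =
  satisfies (vanishes-∣ bc m k bcᵐ m∣k) (vanishes-∣ bac m k bacᵐ m∣k)

satisfies-gcd : ∀ {n m k} → Satisfies n m → Satisfies n k → Satisfies n (gcd m k)
satisfies-gcd {m = m} {k} (satisfies bcᵐ bacᵐ) (satisfies bcᵏ bacᵏ) =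
  satisfies (vanishes-gcd bc m k bcᵐ bcᵏ) (vanishes-gcd bac m k bacᵐ bacᵏ)

-- All relators of H_m hold in H_n once the exponent-m relators do, the
-- first five relators being common to both presentations.
relators-hold : ∀ {n m} → Satisfies n m → ∀ r → Rel m r → NC (Rel n) r
relators-hold _   _ (here r≡a²)                                     = nc-rel (here r≡a²)
relators-hold _   _ (there (here r≡b²))                             = nc-rel (there (here r≡b²))
relators-hold _   _ (there (there (here r≡c²)))                     = nc-rel (there (there (here r≡c²)))
relators-hold _   _ (there (there (there (here r≡ab³))))            = nc-rel (there (there (there (here r≡ab³))))
relators-hold _   _ (there (there (there (there (here r≡ac²)))))    = nc-rel (there (there (there (there (here r≡ac²)))))
relators-hold sat _ (there (there (there (there (there (here refl)))))) = bc-vanishes sat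
relators-hold sat _ (there (there (there (there (there (there (here refl))))))) = bac-vanishes sat
relators-hold _   _ (there (there (there (there (there (there (there ())))))))

-- H_m = H_n when m ∣ n and H_n satisfies the exponent-m relators
-- (the converse inclusion comes from (bc)^n, (bac)^n being powers of (bc)^m, (bac)^m).
divisor-sameH : ∀ {m n} → m ∣ n → Satisfies n m → SameH m n
divisor-sameH {m} m∣n sat w =
  mk⇔ (NC-⊆ (relators-hold sat)) (NC-⊆ (relators-hold (satisfies-∣ (satisfies-own m) m∣n)))

sameH⇒satisfies : ∀ {m n} → SameH m n → Satisfies m n
sameH⇒satisfies {n = n} same =
  satisfies (Equivalence.from (same _) (bc-vanishes (satisfies-own n)))
            (Equivalence.from (same _) (bac-vanishes (satisfies-own n)))

sameH-sym : ∀ {m n} → SameH m n → SameH n m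
sameH-sym same w = ⇔.sym (same w)

primeDivisor : ∀ t → 2 ≤ t → Σ[ p ∈ ℕ ] Prime p × p ∣ t
primeDivisor 0 ()
primeDivisor 1 (s≤s ())
primeDivisor t@(suc (suc _)) _ with factorise t
... | record { factors = [] ; isFactorisation = () }
... | record { factors = p ∷ ps ; isFactorisation = t≡p*ps ; factorsPrime = prime-p ∷ _ } =
  p , prime-p , subst (p ∣_) (sym t≡p*ps) (m∣m*n _)

-- A proper divisor g of d divides d/p for some prime p ∣ d:
-- take p to be a prime factor of the cofactor d/g ≥ 2.
primeCofactor : ∀ {g d} → g ∣ d → g < d → Σ[ p ∈ ℕ ] Prime p × Σ[ p∣d ∈ p ∣ d ] g ∣ quotient p∣d
primeCofactor (divides 0 refl) ()
primeCofactor {g} (divides 1 refl) g<g = ⊥-elim (<-irrefl (sym (+-identityʳ g)) g<g)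
primeCofactor {g} (divides t@(suc (suc _)) refl) _ with primeDivisor t (s≤s (s≤s z≤n))
... | p , prime-p , divides s t≡s*p = p , prime-p , divides (s * g) regroup , divides s refl
  where
  open ≡-Reasoning
  regroup : t * g ≡ s * g * p
  regroup = begin
    t * g       ≡⟨ cong (_* g) t≡s*p ⟩
    s * p * g   ≡⟨ *-assoc s p g ⟩
    s * (p * g) ≡⟨ cong (s *_) (*-comm p g) ⟩
    s * (g * p) ≡⟨ *-assoc s g p ⟨
    s * g * p   ∎

gcd-< : ∀ m n → 1 ≤ n → n < m → gcd m n < m
gcd-< m n 1≤n n<m = ≤-<-trans (∣⇒≤ (gcd[m,n]∣n m n)) n<m
  where instance _ = >-nonZero 1≤n

lemma6p4 : ∀ (d : ℕ) → 1 ≤ d →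
    (Uncollapsed d ⇔ (∀ (p : ℕ) → Prime p → (p∣d : p ∣ d) → ¬ SameH (quotient p∣d) d))
lemma6p4 d 1≤d = mk⇔ onlyIf if
  where
  instance d≢0 : NonZero d
  d≢0 = >-nonZero 1≤d

  onlyIf : Uncollapsed d → ∀ p → Prime p → (p∣d : p ∣ d) → ¬ SameH (quotient p∣d) d
  onlyIf uncollapsed p prime-p p∣d same =
    uncollapsed (quotient p∣d) (>-nonZero⁻¹ _) (quotient-< p∣d) (sameH-sym {quotient p∣d} {d} same)
    where instance _ = prime⇒nonTrivial prime-p
                   _ = quotient≢0 p∣d

  -- A collapse H_d = H_k descends to g = gcd d k and then lifts to d/p.
  if : (∀ p → Prime p → (p∣d : p ∣ d) → ¬ SameH (quotient p∣d) d) → Uncollapsed d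
  if noPrimeCollapse k 1≤k k<d same
    with primeCofactor (gcd[m,n]∣m d k) (gcd-< d k 1≤k k<d)
  ... | p , prime-p , p∣d , g∣d/p =
    noPrimeCollapse p prime-p p∣d (divisor-sameH (quotient-∣ p∣d) (satisfies-∣ gcdRelatorsHold g∣d/p))
    where
    gcdRelatorsHold : Satisfies d (gcd d k)
    gcdRelatorsHold = satisfies-gcd (satisfies-own d) (sameH⇒satisfies {d} {k} same)
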